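{- Let $w=w_1w_2\cdots\in\mathbb{N}^\infty$ and $\pi\in\mathcal{S}_n$. Then $\mathrm{Pat}(w,\Sigma,n)=\pi$ if and only if the following three conditions hold: (i) $w_j-w_i\ge z_j-z_i$ for all $1\le i,j<n$ with $\pi(j)>\pi(i)$ (in particular $w_j\ge z_j$ for all $1\le j<n$); (ii) $w_{[n,\infty)}>w_{[\ell,\infty)}$ if $\pi(n)\ne1$; (iii) $w_{[n,\infty)}<w_{[r,\infty)}$ if $\pi(n)\ne n$.
   Context: $\mathbb{N}=\{0,1,2,\dots\}$. Alternating lexicographical order on sequences: $v<w$ if for some $k\ge1$, $v_1\cdots v_{k-1}=w_1\cdots w_{k-1}$ and $v_k<w_k$ when $k$ is odd, $w_k<v_k$ when $k$ is even. $w_{[i,\infty)}=w_iw_{i+1}\cdots$. $\Sigma$ is the shift map; $\mathrm{Pat}(w,\Sigma,n)=\pi$ means $w_{[\pi^{ -1}(1),\infty)}<w_{[\pi^{ -1}(2),\infty)}<\cdots<w_{[\pi^{ -1}(n),\infty)}$ in this order. For $\pi\in\mathcal{S}_n$: $\ell=\pi^{ -1}(\pi(n)-1)$ if $\pi(n)\ne1$; $r=\pi^{ -1}(\pi(n)+1)$ if $\pi(n)\ne n$; for $1\le j<n$, $z_j=\#\{1\le i<\pi(j):\ (i\ne\pi(n)\ne i+1$ and $\pi(\pi^{ -1}(i)+1)<\pi(\pi^{ -1}(i+1)+1))$ or $(i+1=\pi(n)\ne n$ and $\pi(\ell+1)<\pi(r+1))\}$. -}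

module Defs where

open import Data.Nat using (ℕ; zero; suc; _<_; _∸_; _<?_; _≟_)
open import Data.Fin using (Fin; toℕ; fromℕ<)
open import Data.Fin.Permutation using (Permutation′; _⟨$⟩ʳ_; _⟨$⟩ˡ_)
open import Data.Integer as ℤ using (ℤ; +_)
open import Data.List using (List; length; filter; upTo)
open import Data.Product using (Σ; _×_)
open import Data.Sum using (_⊎_)
open import Relation.Binary.PropositionalEquality using (_≡_; _≢_)
open import Relation.Nullary using (Dec; yes; no; ¬_)
open import Relation.Nullary.Decidable using (_×-dec_; _⊎-dec_; ¬?)

-- Conventions (0-indexed encoding of the paper's 1-indexed objects):
--  * a word w = w_1 w_2 ... ∈ ℕ^∞ is a function w : ℕ → ℕ with w_k = w (k-1);
--  * a position p ∈ {1..n} of π is encoded by p-1, a value v ∈ {1..n} by v-1.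

Seq : Set
Seq = ℕ → ℕ

-- suffix w_{[i,∞)} ; for paper index i, use suffix w (i-1)
suffix : Seq → ℕ → Seq
suffix w i k = w (i Data.Nat.+ k)

-- alternating lexicographic order: v < u iff there is a (paper) index k ≥ 1
-- (here 0-indexed m = k-1) where they first differ, with v_k < u_k if k is odd
-- (m even) and u_k < v_k if k is even (m odd).
data Even : ℕ → Set where
  ev0 : Even zero
  evSS : ∀ {m} → Even m → Even (suc (suc m))

_<alt_ : Seq → Seq → Set
v <alt u = Σ ℕ λ m → ((i : ℕ) → i < m → v i ≡ u i)
                     × ((Even m × v m < u m) ⊎ (¬ Even m × u m < v m))

-- π as functions on ℕ (0-indexed positions ↦ 0-indexed values), extended by 0
-- outside {0..n-1}; only ever evaluated inside the range in the statement.
πℕ : ∀ {n} → Permutation′ n → ℕ → ℕ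
πℕ {n} π p with p <? n
... | yes h = toℕ (π ⟨$⟩ʳ fromℕ< h)
... | no _ = 0

πinvℕ : ∀ {n} → Permutation′ n → ℕ → ℕ
πinvℕ {n} π v with v <? n
... | yes h = toℕ (π ⟨$⟩ˡ fromℕ< h)
... | no _ = 0

module _ {n : ℕ} (π : Permutation′ n) where
  P Q : ℕ → ℕ
  P = πℕ π
  Q = πinvℕ π

  lastPos : ℕ
  lastPos = n ∸ 1

  πn : ℕ
  πn = P lastPos

  ℓpos : ℕ
  ℓpos = Q (πn ∸ 1)

  rpos : ℕ
  rpos = Q (suc πn)

  ZCond : ℕ → Set
  ZCond a = (a ≢ πn × suc a ≢ πn × P (suc (Q a)) < P (suc (Q (suc a))))
          ⊎ (suc a ≡ πn × πn ≢ lastPos × P (suc ℓpos) < P (suc rpos))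

  zcond? : (a : ℕ) → Dec (ZCond a)
  zcond? a = (¬? (a ≟ πn) ×-dec (¬? (suc a ≟ πn) ×-dec (P (suc (Q a)) <? P (suc (Q (suc a))))))
           ⊎-dec ((suc a ≟ πn) ×-dec (¬? (πn ≟ lastPos) ×-dec (P (suc ℓpos) <? P (suc rpos))))

  z : ℕ → ℕ
  z p = length (filter zcond? (upTo (P p)))

Pat : (w : Seq) (n : ℕ) → Permutation′ n → Set
Pat w n π = (a : ℕ) → suc a < n →
  suffix w (πinvℕ π a) <alt suffix w (πinvℕ π (suc a))

CondI : Seq → {n : ℕ} → Permutation′ n → Set
CondI w {n} π = (i j : ℕ) → suc i < n → suc j < n → P π i < P π j →
  (+ z π j) ℤ.- (+ z π i) ℤ.≤ (+ w j) ℤ.- (+ w i)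

CondII : Seq → {n : ℕ} → Permutation′ n → Set
CondII w π = πn π ≢ 0 → suffix w (ℓpos π) <alt suffix w (lastPos π)

CondIII : Seq → {n : ℕ} → Permutation′ n → Set
CondIII w {n} π = πn π ≢ n ∸ 1 → suffix w (lastPos π) <alt suffix w (rpos π)

module Submission where

-- The alternating order is handled through depth-bounded comparisons
-- v <[ k ] u and v ≤[ k ] u, which look only at the first k letters and
-- swap their arguments when passing to the tails; v <alt u holds exactly
-- when v <[ k ] u for some depth k.
--
-- Forward direction: Pat orders the suffixes along the values of π. Two
-- consecutive values a, a+1 (skipping π(n)) then satisfy the local
-- inequality count(a+1) - count(a) ≤ w_{π⁻¹(a+1)} - w_{π⁻¹(a)}, where
-- count(v) counts the values below v satisfying the condition defining z;
-- these local inequalities telescope to condition (i).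
--
-- Backward direction: condition (i) on consecutive values shows, by
-- induction on the depth k, that suffixes are ≤[ k ]-ordered along the
-- values of π; conditions (ii) and (iii) supply one depth M at which the
-- last suffix is strictly separated from its neighbours, and a shifting
-- argument shows that two distinct suffixes cannot agree on M + n letters.
-- Hence the order is strict, which is Pat.

open import Defs
open import Data.Nat using (ℕ; zero; suc; _+_; _∸_; _<_; _≤_; _≤′_; ≤′-refl; ≤′-step; z≤n; s≤s; _≟_; _<?_)
import Data.Nat.Properties as NP
open import Data.Nat.Tactic.RingSolver as NS using ()
open import Data.Integer as ℤ using (ℤ; +_)
import Data.Integer.Properties as ZP
open import Data.Integer.Tactic.RingSolver as ZS using ()
open import Data.Fin using (fromℕ<; toℕ)
import Data.Fin.Properties as FP
open import Data.Fin.Permutation using (Permutation′; _⟨$⟩ʳ_; _⟨$⟩ˡ_; inverseˡ; inverseʳ)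
open import Data.List using (length; filter; upTo; [_]; _++_)
import Data.List.Properties as LP
open import Data.Product using (Σ; _×_; _,_; proj₁; proj₂)
open import Data.Sum using (_⊎_; inj₁; inj₂; [_,_]′)
open import Data.Unit using (⊤; tt)
open import Data.Empty using (⊥; ⊥-elim)
open import Relation.Binary.PropositionalEquality using (_≡_; _≢_; refl; sym; trans; cong; subst; subst₂; module ≡-Reasoning)
open import Relation.Nullary using (¬_; yes; no; Dec)
open import Relation.Nullary.Decidable using (¬?; toSum)
open import Relation.Binary.Definitions using (Tri; tri<; tri≈; tri>)
open import Function.Bundles using (_⇔_; mk⇔)

diff-≤⇒cross : ∀ a b c d → + a ℤ.- + b ℤ.≤ + c ℤ.- + d → a + d ≤ c + b
diff-≤⇒cross a b c d p = ZP.drop‿+≤+ (subst₂ ℤ._≤_ lhs rhs (ZP.+-monoˡ-≤ (+ b ℤ.+ + d) p))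
  where
  add-back : ∀ (x y t : ℤ) → (x ℤ.- y) ℤ.+ (y ℤ.+ t) ≡ x ℤ.+ t
  add-back = ZS.solve-∀
  add-back′ : ∀ (x y t : ℤ) → (x ℤ.- y) ℤ.+ (t ℤ.+ y) ≡ x ℤ.+ t
  add-back′ = ZS.solve-∀
  lhs : (+ a ℤ.- + b) ℤ.+ (+ b ℤ.+ + d) ≡ + (a + d)
  lhs = trans (add-back (+ a) (+ b) (+ d)) (sym (ZP.pos-+ a d))
  rhs : (+ c ℤ.- + d) ℤ.+ (+ b ℤ.+ + d) ≡ + (c + b)
  rhs = trans (add-back′ (+ c) (+ d) (+ b)) (sym (ZP.pos-+ c b))

cross⇒diff-≤ : ∀ a b c d → a + d ≤ c + b → + a ℤ.- + b ℤ.≤ + c ℤ.- + d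
cross⇒diff-≤ a b c d q = subst₂ ℤ._≤_ lhs rhs (ZP.+-monoˡ-≤ (ℤ.- (+ b ℤ.+ + d)) (ℤ.+≤+ q))
  where
  take-off : ∀ (x y t : ℤ) → (x ℤ.+ t) ℤ.- (y ℤ.+ t) ≡ x ℤ.- y
  take-off = ZS.solve-∀
  take-off′ : ∀ (x y t : ℤ) → (x ℤ.+ y) ℤ.- (y ℤ.+ t) ≡ x ℤ.- t
  take-off′ = ZS.solve-∀
  lhs : + (a + d) ℤ.- (+ b ℤ.+ + d) ≡ + a ℤ.- + b
  lhs = trans (cong (ℤ._- (+ b ℤ.+ + d)) (ZP.pos-+ a d)) (take-off (+ a) (+ b) (+ d))
  rhs : + (c + b) ℤ.- (+ b ℤ.+ + d) ≡ + c ℤ.- + d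
  rhs = trans (cong (ℤ._- (+ b ℤ.+ + d)) (ZP.pos-+ c b)) (take-off′ (+ c) (+ b) (+ d))

offset-≤ : ∀ c {x y} → x ≤ y → c + x ≤ y + c
offset-≤ c {x} {y} h = subst (c + x ≤_) (NP.+-comm c y) (NP.+-monoʳ-≤ c h)

offset-≤⁻¹ : ∀ c {x y} → c + x ≤ y + c → x ≤ y
offset-≤⁻¹ c {x} {y} h = NP.+-cancelˡ-≤ c x y (subst (c + x ≤_) (NP.+-comm y c) h)

offset-< : ∀ c {x y} → x < y → suc c + x ≤ y + c
offset-< c {x} {y} h = subst (_≤ y + c) (NP.+-suc c x) (offset-≤ c h)

offset-<⁻¹ : ∀ c {x y} → suc c + x ≤ y + c → x < y
offset-<⁻¹ c {x} {y} h = offset-≤⁻¹ c (subst (_≤ y + c) (sym (NP.+-suc c x)) h)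

cross-trans : ∀ {a b c d x y} → a + x ≤ y + b → c + y ≤ d + a → c + x ≤ d + b
cross-trans {a} {b} {c} {d} {x} {y} p q =
  NP.+-cancelʳ-≤ (a + y) (c + x) (d + b) (subst₂ _≤_ (lhs a x c y) (rhs y b d a) (NP.+-mono-≤ p q))
  where
  lhs : ∀ a x c y → (a + x) + (c + y) ≡ (c + x) + (a + y)
  lhs = NS.solve-∀
  rhs : ∀ y b d a → (y + b) + (d + a) ≡ (d + b) + (a + y)
  rhs = NS.solve-∀

even-or-odd : ∀ k → Even k ⊎ Even (suc k)
even-or-odd zero = inj₁ ev0
even-or-odd (suc k) with even-or-odd k
... | inj₁ e = inj₂ (evSS e)
... | inj₂ e = inj₁ e

¬even-both : ∀ {k} → Even k → Even (suc k) → ⊥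
¬even-both (evSS e) (evSS e′) = ¬even-both e e′

Decisive : ℕ → ℕ → ℕ → Set
Decisive k a b = (Even k × a < b) ⊎ (¬ Even k × b < a)

decisive-pred : ∀ k {a b} → Decisive (suc k) a b → Decisive k b a
decisive-pred k (inj₁ (e , lt)) = inj₂ ((λ e′ → ¬even-both e′ e) , lt)
decisive-pred k (inj₂ (¬e , lt)) with even-or-odd k
... | inj₁ e = inj₁ (e , lt)
... | inj₂ e = ⊥-elim (¬e e)

decisive-suc : ∀ k {a b} → Decisive k b a → Decisive (suc k) a b
decisive-suc k (inj₁ (e , lt)) = inj₂ ((λ e′ → ¬even-both e e′) , lt)
decisive-suc k (inj₂ (¬e , lt)) with even-or-odd k
... | inj₁ e = ⊥-elim (¬e e)
... | inj₂ e = inj₁ (e , lt)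

tail : Seq → Seq
tail v i = v (suc i)

infix 4 _<[_]_ _≤[_]_ _≈[_]_

-- v <[ k ] u : v precedes u in the alternating order, as decided by the
-- first k letters; v ≤[ k ] u : the first k letters do not put u before v.
-- Comparing the tails reverses the order.
_<[_]_ : Seq → ℕ → Seq → Set
v <[ zero ] u = ⊥
v <[ suc k ] u = v 0 < u 0 ⊎ (v 0 ≡ u 0 × tail u <[ k ] tail v)

_≤[_]_ : Seq → ℕ → Seq → Set
v ≤[ zero ] u = ⊤
v ≤[ suc k ] u = v 0 < u 0 ⊎ (v 0 ≡ u 0 × tail u ≤[ k ] tail v)

_≈[_]_ : Seq → ℕ → Seq → Set
v ≈[ k ] u = ∀ i → i < k → v i ≡ u i

<[]⇒≤[] : ∀ k k′ {v u} → v <[ k ] u → v ≤[ k′ ] u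
<[]⇒≤[] k zero p = tt
<[]⇒≤[] (suc k) (suc k′) (inj₁ lt) = inj₁ lt
<[]⇒≤[] (suc k) (suc k′) (inj₂ (e , p)) = inj₂ (e , <[]⇒≤[] k k′ p)

<[]-mono : ∀ {k k′ v u} → k ≤ k′ → v <[ k ] u → v <[ k′ ] u
<[]-mono {suc k} (s≤s h) (inj₁ lt) = inj₁ lt
<[]-mono {suc k} (s≤s h) (inj₂ (e , p)) = inj₂ (e , <[]-mono h p)

≤[]-refl : ∀ k {v} → v ≤[ k ] v
≤[]-refl zero = tt
≤[]-refl (suc k) = inj₂ (refl , ≤[]-refl k)

≤[]-trans : ∀ k {v u t} → v ≤[ k ] u → u ≤[ k ] t → v ≤[ k ] t
≤[]-trans zero p q = tt
≤[]-trans (suc k) (inj₁ x) (inj₁ y) = inj₁ (NP.<-trans x y)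
≤[]-trans (suc k) (inj₁ x) (inj₂ (e , _)) = inj₁ (subst (_ <_) e x)
≤[]-trans (suc k) (inj₂ (e , _)) (inj₁ y) = inj₁ (subst (_< _) (sym e) y)
≤[]-trans (suc k) (inj₂ (e , p)) (inj₂ (e′ , q)) = inj₂ (trans e e′ , ≤[]-trans k q p)

≤-<[]-trans : ∀ k {v u t} → v ≤[ k ] u → u <[ k ] t → v <[ k ] t
<-≤[]-trans : ∀ k {v u t} → v <[ k ] u → u ≤[ k ] t → v <[ k ] t
≤-<[]-trans (suc k) (inj₁ x) (inj₁ y) = inj₁ (NP.<-trans x y)
≤-<[]-trans (suc k) (inj₁ x) (inj₂ (e , _)) = inj₁ (subst (_ <_) e x)
≤-<[]-trans (suc k) (inj₂ (e , _)) (inj₁ y) = inj₁ (subst (_< _) (sym e) y)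
≤-<[]-trans (suc k) (inj₂ (e , p)) (inj₂ (e′ , q)) = inj₂ (trans e e′ , <-≤[]-trans k q p)
<-≤[]-trans (suc k) (inj₁ x) (inj₁ y) = inj₁ (NP.<-trans x y)
<-≤[]-trans (suc k) (inj₁ x) (inj₂ (e , _)) = inj₁ (subst (_ <_) e x)
<-≤[]-trans (suc k) (inj₂ (e , _)) (inj₁ y) = inj₁ (subst (_< _) (sym e) y)
<-≤[]-trans (suc k) (inj₂ (e , p)) (inj₂ (e′ , q)) = inj₂ (trans e e′ , ≤-<[]-trans k q p)

≤[]⇒<⊎≈ : ∀ k {v u} → v ≤[ k ] u → v <[ k ] u ⊎ v ≈[ k ] u
≤[]⇒<⊎≈ zero p = inj₂ (λ i ())
≤[]⇒<⊎≈ (suc k) (inj₁ lt) = inj₁ (inj₁ lt)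
≤[]⇒<⊎≈ (suc k) {v} {u} (inj₂ (e , p)) with ≤[]⇒<⊎≈ k p
... | inj₁ lt = inj₁ (inj₂ (e , lt))
... | inj₂ agree = inj₂ agree′
  where
  agree′ : v ≈[ suc k ] u
  agree′ zero _ = e
  agree′ (suc i) (s≤s h) = sym (agree i h)

<[]-¬≈ : ∀ k {v u} → v <[ k ] u → ¬ v ≈[ k ] u
<[]-¬≈ (suc k) (inj₁ lt) agree = NP.<-irrefl (agree 0 (s≤s z≤n)) lt
<[]-¬≈ (suc k) (inj₂ (e , p)) agree = <[]-¬≈ k p (λ i h → sym (agree (suc i) (s≤s h)))

<[]-resp : ∀ k {v v′ u u′} → (∀ i → v i ≡ v′ i) → (∀ i → u i ≡ u′ i) → v <[ k ] u → v′ <[ k ] u′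
<[]-resp (suc k) ev eu (inj₁ lt) = inj₁ (subst₂ _<_ (ev 0) (eu 0) lt)
<[]-resp (suc k) ev eu (inj₂ (e , p)) =
  inj₂ (trans (sym (ev 0)) (trans e (eu 0)) , <[]-resp k (λ i → eu (suc i)) (λ i → ev (suc i)) p)

≤[]-resp : ∀ k {v v′ u u′} → (∀ i → v i ≡ v′ i) → (∀ i → u i ≡ u′ i) → v ≤[ k ] u → v′ ≤[ k ] u′
≤[]-resp zero _ _ _ = tt
≤[]-resp (suc k) ev eu (inj₁ lt) = inj₁ (subst₂ _<_ (ev 0) (eu 0) lt)
≤[]-resp (suc k) ev eu (inj₂ (e , p)) =
  inj₂ (trans (sym (ev 0)) (trans e (eu 0)) , ≤[]-resp k (λ i → eu (suc i)) (λ i → ev (suc i)) p)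

decided-at : ∀ k {v u} → (∀ i → i < k → v i ≡ u i) → Decisive k (v k) (u k) → v <[ suc k ] u
decided-at zero agree (inj₁ (_ , lt)) = inj₁ lt
decided-at zero agree (inj₂ (¬e , _)) = ⊥-elim (¬e ev0)
decided-at (suc k) agree d =
  inj₂ (agree 0 (s≤s z≤n) , decided-at k (λ i h → sym (agree (suc i) (s≤s h))) (decisive-pred k d))

alt⇒<[] : ∀ {v u} → v <alt u → Σ ℕ λ k → v <[ k ] u
alt⇒<[] (k , agree , d) = suc k , decided-at k agree d

<[]⇒alt : ∀ k {v u} → v <[ k ] u → v <alt u
<[]⇒alt (suc k) (inj₁ lt) = 0 , (λ i ()) , inj₁ (ev0 , lt)
<[]⇒alt (suc k) {v} {u} (inj₂ (e , p)) with <[]⇒alt k p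
... | j , agree , d = suc j , agree′ , decisive-suc j d
  where
  agree′ : ∀ i → i < suc j → v i ≡ u i
  agree′ zero _ = e
  agree′ (suc i) (s≤s h) = sym (agree i h)

alt⇒≤[] : ∀ {v u} → v <alt u → ∀ k → v ≤[ k ] u
alt⇒≤[] h k′ with alt⇒<[] h
... | k , p = <[]⇒≤[] k k′ p

alt-trans : ∀ {v u t} → v <alt u → u <alt t → v <alt t
alt-trans p q with alt⇒<[] p | alt⇒<[] q
... | k , p′ | k′ , q′ =
  <[]⇒alt (k + k′) (≤-<[]-trans (k + k′) (<[]⇒≤[] k (k + k′) p′) (<[]-mono (NP.m≤n+m k′ k) q′))

alt-irrefl : ∀ {v} → ¬ v <alt v
alt-irrefl h with alt⇒<[] h
... | k , p = <[]-¬≈ k p (λ i _ → refl)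

uniform-depth : ∀ {A : Set} {v u} → Dec A → (A → v <alt u) → Σ ℕ λ k → A → v <[ k ] u
uniform-depth (yes a) f with alt⇒<[] (f a)
... | k , p = k , λ _ → p
uniform-depth (no ¬a) f = 0 , λ a → ⊥-elim (¬a a)

suffix-head : ∀ w p → suffix w p 0 ≡ w p
suffix-head w p = cong w (NP.+-identityʳ p)

tail-suffix : ∀ w p i → tail (suffix w p) i ≡ suffix w (suc p) i
tail-suffix w p i = cong w (NP.+-suc p i)

head-step : ∀ w {p q} → suffix w p <alt suffix w q →
            w p < w q ⊎ (w p ≡ w q × suffix w (suc q) <alt suffix w (suc p))
head-step w {p} {q} h with alt⇒<[] h
... | suc k , inj₁ lt = inj₁ (subst₂ _<_ (suffix-head w p) (suffix-head w q) lt)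
... | suc k , inj₂ (e , p′) =
  inj₂ (trans (sym (suffix-head w p)) (trans e (suffix-head w q)) ,
        <[]⇒alt k (<[]-resp k (tail-suffix w q) (tail-suffix w p) p′))

head-≤ : ∀ w {p q} → suffix w p <alt suffix w q → w p ≤ w q
head-≤ w h with head-step w h
... | inj₁ lt = NP.<⇒≤ lt
... | inj₂ (e , _) = NP.≤-reflexive e

≈-shift : ∀ w {x y} s k → suffix w x ≈[ s + k ] suffix w y → suffix w (x + s) ≈[ k ] suffix w (y + s)
≈-shift w {x} {y} s k agree i h = begin
  w (x + s + i)   ≡⟨ cong w (NP.+-assoc x s i) ⟩
  w (x + (s + i)) ≡⟨ agree (s + i) (NP.+-monoʳ-< s h) ⟩
  w (y + (s + i)) ≡⟨ cong w (sym (NP.+-assoc y s i)) ⟩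
  w (y + s + i)   ∎
  where open ≡-Reasoning

≈-weaken : ∀ {k k′ v u} → k ≤ k′ → v ≈[ k′ ] u → v ≈[ k ] u
≈-weaken k≤k′ agree i h = agree i (NP.<-≤-trans h k≤k′)

module PermutationOnℕ {n : ℕ} (π : Permutation′ n) where

  P-in : ∀ {p} (h : p < n) → P π p ≡ toℕ (π ⟨$⟩ʳ fromℕ< h)
  P-in {p} h with p <? n
  ... | yes _ = refl
  ... | no ¬h = ⊥-elim (¬h h)

  Q-in : ∀ {v} (h : v < n) → Q π v ≡ toℕ (π ⟨$⟩ˡ fromℕ< h)
  Q-in {v} h with v <? n
  ... | yes _ = refl
  ... | no ¬h = ⊥-elim (¬h h)

  P<n : ∀ {p} → p < n → P π p < n
  P<n h = subst (_< n) (sym (P-in h)) (FP.toℕ<n _)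

  Q<n : ∀ {v} → v < n → Q π v < n
  Q<n h = subst (_< n) (sym (Q-in h)) (FP.toℕ<n _)

  PQ : ∀ {v} → v < n → P π (Q π v) ≡ v
  PQ {v} h = begin
    P π (Q π v)                        ≡⟨ P-in (Q<n h) ⟩
    toℕ (π ⟨$⟩ʳ fromℕ< (Q<n h))         ≡⟨ cong (λ i → toℕ (π ⟨$⟩ʳ i)) (FP.toℕ-injective (trans (FP.toℕ-fromℕ< _) (Q-in h))) ⟩
    toℕ (π ⟨$⟩ʳ (π ⟨$⟩ˡ fromℕ< h))       ≡⟨ cong toℕ (inverseʳ π) ⟩
    toℕ (fromℕ< h)                     ≡⟨ FP.toℕ-fromℕ< h ⟩
    v                                  ∎
    where open ≡-Reasoning

  QP : ∀ {p} → p < n → Q π (P π p) ≡ p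
  QP {p} h = begin
    Q π (P π p)                        ≡⟨ Q-in (P<n h) ⟩
    toℕ (π ⟨$⟩ˡ fromℕ< (P<n h))         ≡⟨ cong (λ i → toℕ (π ⟨$⟩ˡ i)) (FP.toℕ-injective (trans (FP.toℕ-fromℕ< _) (P-in h))) ⟩
    toℕ (π ⟨$⟩ˡ (π ⟨$⟩ʳ fromℕ< h))       ≡⟨ cong toℕ (inverseˡ π) ⟩
    toℕ (fromℕ< h)                     ≡⟨ FP.toℕ-fromℕ< h ⟩
    p                                  ∎
    where open ≡-Reasoning

  P-injective : ∀ {x y} → x < n → y < n → P π x ≡ P π y → x ≡ y
  P-injective hx hy e = trans (sym (QP hx)) (trans (cong (Q π) e) (QP hy))

  Q-injective : ∀ {x y} → x < n → y < n → Q π x ≡ Q π y → x ≡ y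
  Q-injective hx hy e = trans (sym (PQ hx)) (trans (cong (P π) e) (PQ hy))

module Counting {n : ℕ} (π : Permutation′ n) where

  -- count v = #{ a < v : ZCond a }, so that z p = count (π p).
  count : ℕ → ℕ
  count v = length (filter (zcond? π) (upTo v))

  count-suc : ∀ a → count (suc a) ≡ count a + length (filter (zcond? π) [ a ])
  count-suc a = begin
    length (filter (zcond? π) (upTo (suc a)))              ≡⟨ cong (λ l → length (filter (zcond? π) l)) (sym (LP.applyUpTo-∷ʳ (λ x → x) a)) ⟩
    length (filter (zcond? π) (upTo a ++ [ a ]))           ≡⟨ cong length (LP.filter-++ (zcond? π) (upTo a) [ a ]) ⟩
    length (filter (zcond? π) (upTo a) ++ filter (zcond? π) [ a ]) ≡⟨ LP.length-++ (filter (zcond? π) (upTo a)) ⟩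
    count a + length (filter (zcond? π) [ a ])             ∎
    where open ≡-Reasoning

  count-yes : ∀ a → ZCond π a → count (suc a) ≡ suc (count a)
  count-yes a za = trans (count-suc a)
    (trans (cong (λ l → count a + length l) (LP.filter-accept (zcond? π) za)) (NP.+-comm (count a) 1))

  count-no : ∀ a → ¬ ZCond π a → count (suc a) ≡ count a
  count-no a ¬za = trans (count-suc a)
    (trans (cong (λ l → count a + length l) (LP.filter-reject (zcond? π) ¬za)) (NP.+-identityʳ (count a)))

  count-step : ∀ a {x y} → x ≤ y → (ZCond π a → x < y) → count (suc a) + x ≤ y + count a
  count-step a {x} {y} x≤y strict = by (zcond? π a)
    where
    by : Dec (ZCond π a) → count (suc a) + x ≤ y + count a
    by (yes za) = subst (λ c → c + x ≤ y + count a) (sym (count-yes a za)) (offset-< (count a) (strict za))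
    by (no ¬za) = subst (λ c → c + x ≤ y + count a) (sym (count-no a ¬za)) (offset-≤ (count a) x≤y)

  count-step⁻¹ : ∀ a {x y} → count (suc a) + x ≤ y + count a → x ≤ y × (ZCond π a → x < y)
  count-step⁻¹ a {x} {y} h = by (zcond? π a)
    where
    by : Dec (ZCond π a) → x ≤ y × (ZCond π a → x < y)
    by (yes za) = let x<y = offset-<⁻¹ (count a) (subst (λ c → c + x ≤ y + count a) (count-yes a za) h)
                  in NP.<⇒≤ x<y , λ _ → x<y
    by (no ¬za) = offset-≤⁻¹ (count a) (subst (λ c → c + x ≤ y + count a) (count-no a ¬za) h) ,
                  λ za → ⊥-elim (¬za za)

module Characterisation (m : ℕ) (π : Permutation′ (suc m)) (w : Seq) where
  open PermutationOnℕ π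
  open Counting π

  n : ℕ
  n = suc m

  S : ℕ → Seq
  S = suffix w

  πₙ : ℕ
  πₙ = πn π

  m<n : m < n
  m<n = NP.n<1+n m

  πₙ<n : πₙ < n
  πₙ<n = P<n m<n

  Q-πₙ : Q π πₙ ≡ m
  Q-πₙ = QP m<n

  pred-<n : ∀ {a} → suc a < n → a < n
  pred-<n h = NP.<-trans (NP.n<1+n _) h

  not-last : ∀ {x} → suc x < n → x ≢ m
  not-last h refl = NP.<-irrefl refl h

  next-position : ∀ {x} → x < n → x ≢ m → suc x < n
  next-position h x≢m = s≤s (NP.≤∧≢⇒< (NP.≤-pred h) x≢m)

  next-position-Q : ∀ {v} → v < n → v ≢ πₙ → suc (Q π v) < n
  next-position-Q h v≢πₙ = next-position (Q<n h) (λ e → v≢πₙ (trans (sym (PQ h)) (cong (P π) e)))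

  P-not-last : ∀ {x} → x < n → x ≢ m → P π x ≢ πₙ
  P-not-last h x≢m e = x≢m (P-injective h m<n e)

  -- cross-sum form of condition (i) between the values u ≤ v
  Rise : ℕ → ℕ → Set
  Rise u v = count v + w (Q π u) ≤ w (Q π v) + count u

  -- Rise is reflexive and transitive, so local inequalities telescope.
  rise-refl : ∀ u → Rise u u
  rise-refl u = NP.≤-reflexive (NP.+-comm (count u) (w (Q π u)))

  rise-trans : ∀ u v t → Rise u v → Rise v t → Rise u t
  rise-trans u v t = cross-trans {count v} {count u} {count t} {w (Q π t)} {w (Q π u)} {w (Q π v)}

  module Forward (pat : Pat w n π) where

    ordered : ∀ {u v} → u < v → v < n → S (Q π u) <alt S (Q π v)
    ordered {v = suc v} (s≤s u≤v) h with NP.m≤n⇒m<n∨m≡n u≤v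
    ... | inj₁ u<v = alt-trans (ordered u<v (pred-<n h)) (pat v h)
    ... | inj₂ refl = pat v h

    ordered-positions : ∀ {x y} → x < n → y < n → P π x < P π y → S x <alt S y
    ordered-positions hx hy lt =
      subst₂ (λ a b → S a <alt S b) (QP hx) (QP hy) (ordered lt (P<n hy))

    strict-head : ∀ {p q} → S p <alt S q → suc p < n → suc q < n → P π (suc p) < P π (suc q) → w p < w q
    strict-head h hp hq lt with head-step w h
    ... | inj₁ w<w = w<w
    ... | inj₂ (_ , back) = ⊥-elim (alt-irrefl (alt-trans back (ordered-positions hp hq lt)))

    rise-adjacent : ∀ a → suc a < n → a ≢ πₙ → suc a ≢ πₙ → Rise a (suc a)
    rise-adjacent a h a≢ sa≢ = count-step a (head-≤ w (pat a h)) strict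
      where
      strict : ZCond π a → w (Q π a) < w (Q π (suc a))
      strict (inj₁ (_ , _ , lt)) =
        strict-head (pat a h) (next-position-Q (pred-<n h) a≢) (next-position-Q h sa≢) lt
      strict (inj₂ (e , _)) = ⊥-elim (sa≢ e)

    -- condition (i) between the values a and a+2 around a+1 = π(n);
    -- here ZCond compares π(ℓ+1) with π(r+1)
    rise-across : ∀ a → suc (suc a) < n → suc a ≡ πₙ → Rise a (suc (suc a))
    rise-across a h e =
      subst (λ c → c + w (Q π a) ≤ w (Q π (suc (suc a))) + count a)
            (sym (count-no (suc a) not-counted))
            (count-step a (head-≤ w around) strict)
      where
      ha : a < n
      ha = pred-<n (pred-<n h)
      around : S (Q π a) <alt S (Q π (suc (suc a)))
      around = ordered (NP.<-trans (NP.n<1+n a) (NP.n<1+n (suc a))) h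
      not-counted : ¬ ZCond π (suc a)
      not-counted (inj₁ (≢πₙ , _)) = ≢πₙ e
      not-counted (inj₂ (e′ , _)) = NP.1+n≢n (trans e′ (sym e))
      strict : ZCond π a → w (Q π a) < w (Q π (suc (suc a)))
      strict (inj₁ (_ , sa≢ , _)) = ⊥-elim (sa≢ e)
      strict (inj₂ (_ , _ , lt)) =
        strict-head around
          (next-position-Q ha (λ e′ → NP.1+n≢n (trans e (sym e′))))
          (next-position-Q h (λ e′ → NP.1+n≢n (trans e′ (sym e))))
          (subst₂ (λ x y → P π (suc (Q π x)) < P π (suc (Q π y))) (cong (_∸ 1) (sym e)) (cong suc (sym e)) lt)

    -- The local inequalities telescope along the values, skipping π(n).
    rise : ∀ {u v} → u ≤′ v → v < n → u ≢ πₙ → v ≢ πₙ → Rise u v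
    rise {u} ≤′-refl _ _ _ = rise-refl u
    rise {u} (≤′-step ≤′-refl) h u≢ su≢ = rise-adjacent u h u≢ su≢
    rise {u} (≤′-step (≤′-step {v} u≤′v)) h u≢ ssv≢ =
      [ (λ e → rise-trans u v (suc (suc v))
                 (rise u≤′v (pred-<n (pred-<n h)) u≢ (λ e′ → NP.1+n≢n (trans e (sym e′))))
                 (rise-across v h e))
      , (λ sv≢ → rise-trans u (suc v) (suc (suc v))
                   (rise (≤′-step u≤′v) (pred-<n h) u≢ sv≢)
                   (rise-adjacent (suc v) h sv≢ ssv≢))
      ]′ (toSum (suc v ≟ πₙ))

    condI : CondI w π
    condI i j hi hj lt = cross⇒diff-≤ (z π j) (z π i) (w j) (w i)
      (subst₂ (λ x y → count (P π j) + w x ≤ w y + count (P π i)) (QP (pred-<n hi)) (QP (pred-<n hj))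
        (rise (NP.≤⇒≤′ (NP.<⇒≤ lt)) (P<n (pred-<n hj))
              (P-not-last (pred-<n hi) (not-last hi)) (P-not-last (pred-<n hj) (not-last hj))))

    condII : CondII w π
    condII πₙ≢0 = subst (λ x → S (ℓpos π) <alt S x) Q-πₙ (ordered (pred< πₙ≢0) πₙ<n)
      where
      pred< : ∀ {x} → x ≢ 0 → x ∸ 1 < x
      pred< {zero} x≢0 = ⊥-elim (x≢0 refl)
      pred< {suc x} _ = NP.n<1+n x

    condIII : CondIII w π
    condIII πₙ≢m = subst (λ x → S x <alt S (rpos π)) Q-πₙ
      (ordered (NP.n<1+n πₙ) (next-position πₙ<n πₙ≢m))

  module Backward (c1 : CondI w π) (c2 : CondII w π) (c3 : CondIII w π) where

    adjacent : ∀ a → suc a < n → a ≢ πₙ → suc a ≢ πₙ →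
               w (Q π a) < w (Q π (suc a)) ⊎
               (w (Q π a) ≡ w (Q π (suc a)) × P π (suc (Q π (suc a))) < P π (suc (Q π a)))
    adjacent a h a≢ sa≢ = decide (NP.m≤n⇒m<n∨m≡n (proj₁ letters))
      where
      ha : a < n
      ha = pred-<n h
      hp : suc (Q π a) < n
      hp = next-position-Q ha a≢
      hq : suc (Q π (suc a)) < n
      hq = next-position-Q h sa≢
      rise : Rise a (suc a)
      rise = subst₂ (λ x y → count x + w (Q π a) ≤ w (Q π (suc a)) + count y) (PQ h) (PQ ha)
        (diff-≤⇒cross (z π (Q π (suc a))) (z π (Q π a)) (w (Q π (suc a))) (w (Q π a))
          (c1 (Q π a) (Q π (suc a)) hp hq (subst₂ _<_ (sym (PQ ha)) (sym (PQ h)) (NP.n<1+n a))))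
      letters : w (Q π a) ≤ w (Q π (suc a)) × (ZCond π a → w (Q π a) < w (Q π (suc a)))
      letters = count-step⁻¹ a rise
      decide : w (Q π a) < w (Q π (suc a)) ⊎ w (Q π a) ≡ w (Q π (suc a)) →
               w (Q π a) < w (Q π (suc a)) ⊎
               (w (Q π a) ≡ w (Q π (suc a)) × P π (suc (Q π (suc a))) < P π (suc (Q π a)))
      decide (inj₁ lt) = inj₁ lt
      decide (inj₂ e) = inj₂ (e , NP.≤∧≢⇒< (NP.≮⇒≥ not-counted) distinct)
        where
        not-counted : ¬ P π (suc (Q π a)) < P π (suc (Q π (suc a)))
        not-counted lt = NP.<-irrefl e (proj₂ letters (inj₁ (a≢ , sa≢ , lt)))
        distinct : P π (suc (Q π (suc a))) ≢ P π (suc (Q π a))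
        distinct e′ = NP.1+n≢n (Q-injective h ha (NP.suc-injective (P-injective hq hp e′)))

    below-last : ∀ a → suc a ≡ πₙ → S (Q π a) <alt S (Q π (suc a))
    below-last a e = subst₂ (λ x y → S x <alt S y)
      (cong (λ t → Q π (t ∸ 1)) (sym e)) (trans (sym Q-πₙ) (cong (Q π) (sym e)))
      (c2 (λ e₀ → NP.0≢1+n (sym (trans e e₀))))

    above-last : ∀ a → suc a < n → a ≡ πₙ → S (Q π a) <alt S (Q π (suc a))
    above-last a h e = subst₂ (λ x y → S x <alt S y)
      (trans (sym Q-πₙ) (cong (Q π) (sym e))) (cong (λ t → Q π (suc t)) (sym e))
      (c3 (λ e₀ → not-last h (trans e e₀)))

    step-≤ : ∀ k a → suc a < n → S (Q π a) ≤[ k ] S (Q π (suc a))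
    ordered-≤ : ∀ k {u v} → u ≤′ v → v < n → S (Q π u) ≤[ k ] S (Q π v)

    equal-heads : ∀ k {p q} → suc p < n → suc q < n → w p ≡ w q →
                  P π (suc q) < P π (suc p) → S p ≤[ suc k ] S q
    equal-heads k {p} {q} hp hq e desc =
      inj₂ (trans (suffix-head w p) (trans e (sym (suffix-head w q))) ,
            ≤[]-resp k (λ i → sym (tail-suffix w q i)) (λ i → sym (tail-suffix w p i))
              (subst₂ (λ x y → S x ≤[ k ] S y) (QP hq) (QP hp)
                (ordered-≤ k (NP.≤⇒≤′ (NP.<⇒≤ desc)) (P<n hp))))

    step-≤ zero a h = tt
    step-≤ (suc k) a h = by-cases (suc a ≟ πₙ) (a ≟ πₙ)
      where
      G : Set
      G = S (Q π a) ≤[ suc k ] S (Q π (suc a))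
      by-letters : (a≢ : a ≢ πₙ) (sa≢ : suc a ≢ πₙ) →
                   w (Q π a) < w (Q π (suc a)) ⊎
                   (w (Q π a) ≡ w (Q π (suc a)) × P π (suc (Q π (suc a))) < P π (suc (Q π a))) → G
      by-letters a≢ sa≢ (inj₁ lt) =
        inj₁ (subst₂ _<_ (sym (suffix-head w (Q π a))) (sym (suffix-head w (Q π (suc a)))) lt)
      by-letters a≢ sa≢ (inj₂ (e , desc)) =
        equal-heads k (next-position-Q (pred-<n h) a≢) (next-position-Q h sa≢) e desc
      by-cases : Dec (suc a ≡ πₙ) → Dec (a ≡ πₙ) → G
      by-cases (yes e) _ = alt⇒≤[] (below-last a e) (suc k)
      by-cases (no _) (yes e) = alt⇒≤[] (above-last a h e) (suc k)
      by-cases (no sa≢) (no a≢) = by-letters a≢ sa≢ (adjacent a h a≢ sa≢)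

    ordered-≤ k ≤′-refl _ = ≤[]-refl k
    ordered-≤ k (≤′-step {v} u≤′v) h = ≤[]-trans k (ordered-≤ k u≤′v (pred-<n h)) (step-≤ k v h)

    depth-ℓ : Σ ℕ λ k → πₙ ≢ 0 → S (ℓpos π) <[ k ] S m
    depth-ℓ = uniform-depth (¬? (πₙ ≟ 0)) c2

    depth-r : Σ ℕ λ k → πₙ ≢ m → S m <[ k ] S (rpos π)
    depth-r = uniform-depth (¬? (πₙ ≟ m)) c3

    M : ℕ
    M = proj₁ depth-ℓ + proj₁ depth-r

    ℓ<last : πₙ ≢ 0 → S (ℓpos π) <[ M ] S m
    ℓ<last h = <[]-mono (NP.m≤m+n _ _) (proj₂ depth-ℓ h)

    last<r : πₙ ≢ m → S m <[ M ] S (rpos π)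
    last<r h = <[]-mono (NP.m≤n+m _ (proj₁ depth-ℓ)) (proj₂ depth-r h)

    below-ℓ : ∀ k {x} → x < n → P π x < πₙ → S x ≤[ k ] S (ℓpos π)
    below-ℓ k {x} hx lt = subst (λ t → S t ≤[ k ] S (ℓpos π)) (QP hx)
      (ordered-≤ k (NP.≤⇒≤′ (≤-pred′ lt)) (NP.≤-<-trans (NP.m∸n≤m πₙ 1) πₙ<n))
      where
      ≤-pred′ : ∀ {u v} → u < v → u ≤ v ∸ 1
      ≤-pred′ (s≤s u≤v) = u≤v

    above-r : ∀ k {x} → x < n → πₙ < P π x → S (rpos π) ≤[ k ] S x
    above-r k {x} hx gt = subst (λ t → S (rpos π) ≤[ k ] S t) (QP hx)
      (ordered-≤ k (NP.≤⇒≤′ gt) (P<n hx))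

    last-separated : ∀ {x} → x < m → ¬ S x ≈[ M ] S m
    last-separated {x} x<m agree = by-value (NP.<-cmp (P π x) πₙ)
      where
      hx : x < n
      hx = NP.<-trans x<m m<n
      by-value : Tri (P π x < πₙ) (P π x ≡ πₙ) (πₙ < P π x) → ⊥
      by-value (tri< lt _ _) = <[]-¬≈ M (≤-<[]-trans M (below-ℓ M hx lt) (ℓ<last πₙ≢0)) agree
        where
        πₙ≢0 : πₙ ≢ 0
        πₙ≢0 e = NP.n≮0 (subst (P π x <_) e lt)
      by-value (tri≈ _ e _) = P-not-last hx (λ e′ → NP.<-irrefl e′ x<m) e
      by-value (tri> _ _ gt) = <[]-¬≈ M (<-≤[]-trans M (last<r πₙ≢m) (above-r M hx gt)) (λ i h → sym (agree i h))
        where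
        πₙ≢m : πₙ ≢ m
        πₙ≢m e = NP.<⇒≱ gt (subst (P π x ≤_) (sym e) (NP.≤-pred (P<n hx)))

    -- Suffixes at positions x < y differ within M + n letters: otherwise,
    -- shifting both by m - y yields an earlier suffix agreeing with the last on M letters.
    separated : ∀ {x y} → x < y → y < n → ¬ S x ≈[ M + n ] S y
    separated {x} {y} x<y hy agree =
      last-separated x+s<m (subst (λ t → S (x + s) ≈[ M ] S t) y+s≡m (≈-shift w s M (≈-weaken s+M≤M+n agree)))
      where
      s = m ∸ y
      y+s≡m : y + s ≡ m
      y+s≡m = NP.m+[n∸m]≡n (NP.≤-pred hy)
      x+s<m : x + s < m
      x+s<m = subst (x + s <_) y+s≡m (NP.+-monoˡ-< s x<y)
      s+M≤M+n : s + M ≤ M + n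
      s+M≤M+n = subst (_≤ M + n) (NP.+-comm M s) (NP.+-monoʳ-≤ M (NP.≤-trans (NP.m∸n≤m m y) (NP.n≤1+n m)))

    distinct-separated : ∀ {x y} → x ≢ y → x < n → y < n → ¬ S x ≈[ M + n ] S y
    distinct-separated {x} {y} x≢y hx hy agree = by-order (NP.<-cmp x y)
      where
      by-order : Tri (x < y) (x ≡ y) (y < x) → ⊥
      by-order (tri< lt _ _) = separated lt hy agree
      by-order (tri≈ _ e _) = x≢y e
      by-order (tri> _ _ gt) = separated gt hx (λ i h → sym (agree i h))

    pat : Pat w n π
    pat a h = strict-or-equal (≤[]⇒<⊎≈ (M + n) (step-≤ (M + n) a h))
      where
      Q-distinct : Q π a ≢ Q π (suc a)
      Q-distinct e = NP.1+n≢n (sym (Q-injective (pred-<n h) h e))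
      strict-or-equal : S (Q π a) <[ M + n ] S (Q π (suc a)) ⊎ S (Q π a) ≈[ M + n ] S (Q π (suc a)) →
                        S (Q π a) <alt S (Q π (suc a))
      strict-or-equal (inj₁ lt) = <[]⇒alt (M + n) lt
      strict-or-equal (inj₂ agree) = ⊥-elim (distinct-separated Q-distinct (Q<n (pred-<n h)) (Q<n h) agree)

proposition1 : (n : ℕ) → 0 < n → (π : Permutation′ n) → (w : ℕ → ℕ) →
    Pat w n π ⇔ (CondI w π × CondII w π × CondIII w π)
proposition1 (suc m) _ π w =
  mk⇔ (λ pat → Forward.condI pat , Forward.condII pat , Forward.condIII pat)
      (λ { (c1 , c2 , c3) → Backward.pat c1 c2 c3 })
  where open Characterisation m π w
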